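{- For every integer $i>3$, the ordered matching $M^C_i$ is edge-collapsible.
   Context: An ordered graph is a finite graph together with a total order $\le$ on its vertex set; an ordered subgraph carries the restriction of the order. For ordered graphs $G,H$, an ordered homomorphism $f:G\to H$ is a map $f:V(G)\to V(H)$ such that $uv\in E(G)$ implies $f(u)f(v)\in E(H)$, and $u\le v$ implies $f(u)\le f(v)$. $P_2$ denotes the ordered graph with two vertices and one edge. An ordered graph $G$ is edge-collapsible if the only ordered subgraph $H$ of $G$ for which there exists an ordered homomorphism $G\to H$ is (an ordered subgraph isomorphic to) $P_2$. The ordered matchings $M^C_i$ ($i\ge 4$, with $i$ edges) are defined as follows. $M^C_4$ has vertices $v_1<\dots<v_8$ and edges $\{v_1,v_6\},\{v_2,v_8\},\{v_3,v_5\},\{v_4,v_7\}$. For $i>4$, take $M^C_{i-1}$ with vertices $v_1<\dots<v_{2(i-1)}$; if $i$ is odd, add a new vertex $w$ between $v_{i-1}$ and $v_i$; if $i$ is even, add a new vertex $w$ after $v_{2(i-1)}$; in both cases add a new vertex $v$ before $v_1$, and add the edge $\{v,w\}$. The result is $M^C_i$. -}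

module Defs where

open import Data.Nat using (ℕ; zero; suc; _+_; _*_; _∸_; _<ᵇ_)
open import Data.Bool using (Bool; true; false; if_then_else_; not)
open import Data.Fin using (Fin; toℕ) renaming (_≤_ to _≤ᶠ_; _<_ to _<ᶠ_)
open import Data.List using (List; []; _∷_; map)
open import Data.List.Membership.Propositional using (_∈_)
open import Data.Product using (_×_; _,_; Σ; ∃; ∃-syntax)
open import Data.Sum using (_⊎_)
open import Relation.Binary.PropositionalEquality using (_≡_)
open import Function.Bundles using (_⇔_)
open import Data.Sum using (inj₁; inj₂)

-- An ordered graph on n vertices has vertex set Fin n,
-- totally ordered by the usual order of Fin n; its edges are given by a
-- symmetric adjacency relation (looplessness is not needed here; the
-- graphs M^C_i are loopless anyway).

record OrderedGraph (n : ℕ) : Set₁ where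
  field
    E     : Fin n → Fin n → Set
    sym   : ∀ {u v} → E u v → E v u
open OrderedGraph public

record Subgraph {n : ℕ} (G : OrderedGraph n) : Set₁ where
  field
    V      : Fin n → Set
    EH     : Fin n → Fin n → Set
    EH-sym : ∀ {u v} → EH u v → EH v u
    EH⊆    : ∀ {u v} → EH u v → V u × V v × E G u v
open Subgraph public

record OrdHom {n : ℕ} (G : OrderedGraph n) (H : Subgraph G) : Set where
  field
    f       : Fin n → Fin n
    f-into  : ∀ u → V H (f u)
    f-edge  : ∀ {u v} → E G u v → EH H (f u) (f v)
    f-mono  : ∀ {u v} → u ≤ᶠ v → f u ≤ᶠ f v
open OrdHom public

_⊑_ : ∀ {n} {G : OrderedGraph n} → Subgraph G → Subgraph G → Set
H' ⊑ H = (∀ x → V H' x → V H x) × (∀ x y → EH H' x y → EH H x y)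

IsoP₂ : ∀ {n} {G : OrderedGraph n} → Subgraph G → Set
IsoP₂ {n} H = ∃[ a ] ∃[ b ] (a <ᶠ b)
  × (∀ x → V H x ⇔ (x ≡ a ⊎ x ≡ b))
  × (∀ x y → EH H x y ⇔ ((x ≡ a × y ≡ b) ⊎ (x ≡ b × y ≡ a)))

MinimalHomImage : ∀ {n} (G : OrderedGraph n) → Subgraph G → Set₁
MinimalHomImage G H = OrdHom G H
  × (∀ (H' : Subgraph G) → H' ⊑ H → OrdHom G H' → H ⊑ H')

EdgeCollapsible : ∀ {n} → OrderedGraph n → Set₁
EdgeCollapsible G =
  (Σ (Subgraph G) λ H → IsoP₂ H × OrdHom G H)
  × (∀ (H : Subgraph G) → MinimalHomImage G H → IsoP₂ H)

-- The matchings M^C_i, with vertices numbered 0 … 2i-1 (position 0 is v₁).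

even? : ℕ → Bool
even? zero    = true
even? (suc k) = not (even? k)

-- mc k is the edge list (as pairs of positions) of M^C_{k+4}.
mc : ℕ → List (ℕ × ℕ)
mc zero = (0 , 5) ∷ (1 , 7) ∷ (2 , 4) ∷ (3 , 6) ∷ []
mc (suc k) with even? k
-- i = k+5 odd: new vertex v at position 0, old positions 0..i-2 shift by 1,
-- w at position i (between old v_{i-1} and v_i), the rest shift by 2.
... | true  = (0 , k + 5) ∷ map (λ { (x , y) → sh x , sh y }) (mc k)
  where sh : ℕ → ℕ
        sh x = if x <ᵇ (k + 4) then suc x else suc (suc x)
-- i = k+5 even: new v at position 0, everything shifts by 1,
-- w at the end (position 2i-1).
... | false = (0 , 2 * (k + 5) ∸ 1) ∷ map (λ { (x , y) → suc x , suc y }) (mc k)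

MCEdge : (i : ℕ) → Fin (2 * i) → Fin (2 * i) → Set
MCEdge i u v = ((toℕ u , toℕ v) ∈ mc (i ∸ 4)) ⊎ ((toℕ v , toℕ u) ∈ mc (i ∸ 4))

MC : (i : ℕ) → OrderedGraph (2 * i)
MC i = record { E = MCEdge i ; sym = λ { (inj₁ p) → inj₂ p ; (inj₂ p) → inj₁ p } }

module Submission where

open import Defs
open import Data.Nat using (ℕ; _<_; zero; suc; _+_; _*_; _∸_; _<ᵇ_; z≤n; s≤s; z<s; _≤_; _<?_; _≤?_)
open import Data.Nat.Properties
open import Data.Bool using (true; false; if_then_else_)
open import Data.Fin using (Fin; toℕ; fromℕ<) renaming (_≤_ to _≤ᶠ_; _<_ to _<ᶠ_)
open import Data.Fin.Properties using (toℕ-fromℕ<)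
open import Data.List.Membership.Propositional using (_∈_)
open import Data.List.Relation.Unary.All as All using (All; _∷_)
open import Data.List.Relation.Unary.All.Properties using (map⁺)
open import Data.List.Relation.Unary.Any using (here)
open import Data.Product using (_×_; _,_; Σ; ∃₂; proj₁; proj₂)
open import Data.Sum using (_⊎_; inj₁; inj₂)
open import Data.Empty using (⊥-elim)
open import Relation.Nullary using (yes; no)
open import Relation.Nullary.Decidable using (toWitness; _×-dec_)
open import Relation.Unary using (Decidable)
open import Relation.Binary.PropositionalEquality using (_≡_; refl; cong; subst; subst₂)
  renaming (sym to ≡-sym)
open import Function.Bundles using (mk⇔; Equivalence)

-- Every edge of M^C_i joins the first half v₁ … v_i of the vertices to the
-- second half.  For an ordered graph all of whose edges cross such a cut t,
-- collapsing everything left of t onto the left end of an edge ab and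
-- everything else onto b is an ordered homomorphism onto the single edge ab.
-- A minimal homomorphic image H therefore contains the image of an edge, which
-- again crosses t, and by minimality H is exactly that edge, i.e. a copy of P₂.

IsoP₂-cong : ∀ {n} {G : OrderedGraph n} {H H' : Subgraph G} →
             H ⊑ H' → H' ⊑ H → IsoP₂ H → IsoP₂ H'
IsoP₂-cong (V⊆ , E⊆) (V⊇ , E⊇) (a , b , a<b , V⇔ , E⇔) =
    a , b , a<b
  , (λ x → mk⇔ (λ p → Equivalence.to (V⇔ x) (V⊇ x p)) (λ p → V⊆ x (Equivalence.from (V⇔ x) p)))
  , (λ x y → mk⇔ (λ p → Equivalence.to (E⇔ x y) (E⊇ x y p))
                 (λ p → E⊆ x y (Equivalence.from (E⇔ x y) p)))

module _ {n : ℕ} (G : OrderedGraph n) where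

  edgeSubgraph : ∀ {a b} → E G a b → Subgraph G
  edgeSubgraph {a} {b} eab = record
    { V      = λ x → x ≡ a ⊎ x ≡ b
    ; EH     = λ x y → (x ≡ a × y ≡ b) ⊎ (x ≡ b × y ≡ a)
    ; EH-sym = λ { (inj₁ (p , q)) → inj₂ (q , p) ; (inj₂ (p , q)) → inj₁ (q , p) }
    ; EH⊆    = λ { (inj₁ (refl , refl)) → inj₁ refl , inj₂ refl , eab
                 ; (inj₂ (refl , refl)) → inj₂ refl , inj₁ refl , OrderedGraph.sym G eab }
    }

  edgeSubgraph-IsoP₂ : ∀ {a b} (eab : E G a b) → a <ᶠ b → IsoP₂ (edgeSubgraph eab)
  edgeSubgraph-IsoP₂ {a} {b} _ a<b =
    a , b , a<b , (λ _ → mk⇔ (λ p → p) (λ p → p)) , (λ _ _ → mk⇔ (λ p → p) (λ p → p))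

  edgeSubgraph-⊑ : ∀ {a b} (eab : E G a b) (H : Subgraph G) → EH H a b → edgeSubgraph eab ⊑ H
  edgeSubgraph-⊑ _ H eH =
      (λ { _ (inj₁ refl) → proj₁ (EH⊆ H eH) ; _ (inj₂ refl) → proj₁ (proj₂ (EH⊆ H eH)) })
    , (λ { _ _ (inj₁ (refl , refl)) → eH ; _ _ (inj₂ (refl , refl)) → EH-sym H eH })

Crosses : ∀ {n} → ℕ → Fin n → Fin n → Set
Crosses t u v = toℕ u < t × t ≤ toℕ v

Crosses⇒< : ∀ {n t} {u v : Fin n} → Crosses t u v → u <ᶠ v
Crosses⇒< (u<t , t≤v) = <-≤-trans u<t t≤v

module _ {n : ℕ} (G : OrderedGraph n) (t : ℕ)
         (crossing : ∀ {u v} → E G u v → Crosses t u v ⊎ Crosses t v u) where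

  crossing-≤ : ∀ {u v} → E G u v → u ≤ᶠ v → Crosses t u v
  crossing-≤ euv u≤v with crossing euv
  ... | inj₁ c = c
  ... | inj₂ c = ⊥-elim (<⇒≱ (Crosses⇒< c) u≤v)

  collapse : Fin n → Fin n → Fin n → Fin n
  collapse a b x with toℕ x <? t
  ... | yes _ = a
  ... | no  _ = b

  collapse-left : ∀ a b x → toℕ x < t → collapse a b x ≡ a
  collapse-left a b x x<t with toℕ x <? t
  ... | yes _   = refl
  ... | no  x≮t = ⊥-elim (x≮t x<t)

  collapse-right : ∀ a b x → t ≤ toℕ x → collapse a b x ≡ b
  collapse-right a b x t≤x with toℕ x <? t
  ... | yes x<t = ⊥-elim (<⇒≱ x<t t≤x)
  ... | no  _   = refl

  collapse-hom : ∀ {a b} (eab : E G a b) → a ≤ᶠ b → OrdHom G (edgeSubgraph G eab)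
  collapse-hom {a} {b} _ a≤b = record
    { f = collapse a b ; f-into = into ; f-edge = edge ; f-mono = mono }
    where
    into : ∀ x → collapse a b x ≡ a ⊎ collapse a b x ≡ b
    into x with toℕ x <? t
    ... | yes _ = inj₁ refl
    ... | no  _ = inj₂ refl

    edge : ∀ {u v} → E G u v →
           (collapse a b u ≡ a × collapse a b v ≡ b) ⊎ (collapse a b u ≡ b × collapse a b v ≡ a)
    edge {u} {v} euv with crossing euv
    ... | inj₁ (u<t , t≤v) = inj₁ (collapse-left a b u u<t , collapse-right a b v t≤v)
    ... | inj₂ (v<t , t≤u) = inj₂ (collapse-right a b u t≤u , collapse-left a b v v<t)

    mono : ∀ {u v} → u ≤ᶠ v → collapse a b u ≤ᶠ collapse a b v
    mono {u} {v} u≤v with toℕ u <? t | toℕ v <? t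
    ... | yes _   | yes _   = ≤-refl
    ... | yes _   | no  _   = a≤b
    ... | no  _   | no  _   = ≤-refl
    ... | no  u≮t | yes v<t = ⊥-elim (u≮t (≤-<-trans u≤v v<t))

  MinimalHomImage⇒IsoP₂ : ∀ {a b} → E G a b → a ≤ᶠ b →
                          (H : Subgraph G) → MinimalHomImage G H → IsoP₂ H
  MinimalHomImage⇒IsoP₂ {a} {b} eab a≤b H (F , minimal) =
    IsoP₂-cong {H = edgeSubgraph G eFab} {H' = H} (edgeSubgraph-⊑ G eFab H eH) H⊑edge
      (edgeSubgraph-IsoP₂ G eFab (Crosses⇒< (crossing-≤ eFab Fa≤Fb)))
    where
    eH : EH H (f F a) (f F b)
    eH = f-edge F eab
    eFab : E G (f F a) (f F b)
    eFab = proj₂ (proj₂ (EH⊆ H eH))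
    Fa≤Fb : f F a ≤ᶠ f F b
    Fa≤Fb = f-mono F a≤b
    H⊑edge : H ⊑ edgeSubgraph G eFab
    H⊑edge = minimal (edgeSubgraph G eFab) (edgeSubgraph-⊑ G eFab H eH) (collapse-hom eFab Fa≤Fb)

  crossing⇒EdgeCollapsible : ∀ {a b} → E G a b → Crosses t a b → EdgeCollapsible G
  crossing⇒EdgeCollapsible eab c =
      (edgeSubgraph G eab , edgeSubgraph-IsoP₂ G eab a<b , collapse-hom eab (<⇒≤ a<b))
    , MinimalHomImage⇒IsoP₂ eab (<⇒≤ a<b)
    where
    a<b : _ <ᶠ _
    a<b = Crosses⇒< c

Straddles : ℕ → ℕ × ℕ → Set
Straddles t (x , y) = x < t × t ≤ y × y < 2 * t

straddles? : ∀ t → Decidable (Straddles t)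
straddles? t (x , y) = (x <? t) ×-dec (t ≤? y) ×-dec (y <? 2 * t)

2*suc : ∀ t → 2 * suc t ≡ suc (suc (2 * t))
2*suc t = *-suc 2 t

-- New position of an old vertex of M^C_{i-1} in M^C_i for odd i = t + 1 (Defs: sh).
gap : ℕ → ℕ → ℕ
gap t x = if x <ᵇ t then suc x else suc (suc x)

gap-below : ∀ {t x} → x < t → gap t x ≡ suc x
gap-below {t} {x} x<t with x <ᵇ t | <⇒<ᵇ x<t
... | true | _ = refl

gap-bounds : ∀ t x → suc x ≤ gap t x × gap t x ≤ suc (suc x)
gap-bounds t x with x <ᵇ t
... | true  = ≤-refl , n≤1+n _
... | false = n≤1+n _ , ≤-refl

straddles-gap : ∀ {t x y} → Straddles t (x , y) → Straddles (suc t) (gap t x , gap t y)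
straddles-gap {t} {x} {y} (x<t , t≤y , y<2t) =
    subst (_< suc t) (≡-sym (gap-below x<t)) (s≤s x<t)
  , ≤-trans (s≤s t≤y) (proj₁ (gap-bounds t y))
  , ≤-<-trans (proj₂ (gap-bounds t y)) (subst (suc (suc y) <_) (≡-sym (2*suc t)) (s≤s (s≤s y<2t)))

straddles-suc : ∀ {t x y} → Straddles t (x , y) → Straddles (suc t) (suc x , suc y)
straddles-suc {t} {x} {y} (x<t , t≤y , y<2t) =
  s≤s x<t , s≤s t≤y , subst (suc y <_) (≡-sym (2*suc t)) (m<n⇒m<1+n (s≤s y<2t))

straddles-middle : ∀ t → Straddles (suc t) (0 , suc t)
straddles-middle t =
  z<s , ≤-refl , subst (suc t <_) (≡-sym (2*suc t)) (s≤s (s≤s (m≤m+n t (t + 0))))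

straddles-last : ∀ t → Straddles (suc t) (0 , 2 * suc t ∸ 1)
straddles-last t =
  z<s , subst (suc t ≤_) last≡ (s≤s (m≤m+n t (t + 0))) , subst (_< 2 * suc t) last≡ (≤-reflexive (≡-sym (2*suc t)))
  where
  last≡ : suc (2 * t) ≡ 2 * suc t ∸ 1
  last≡ = cong (_∸ 1) (≡-sym (2*suc t))

mc-straddles : ∀ k → All (Straddles (k + 4)) (mc k)
mc-straddles zero = toWitness {a? = All.all? (straddles? 4) (mc 0)} _
mc-straddles (suc k) with even? k
... | true  = subst (λ s → Straddles (suc (k + 4)) (0 , s)) (≡-sym (+-suc k 4)) (straddles-middle (k + 4))
            ∷ map⁺ (All.map straddles-gap (mc-straddles k))
... | false = subst (λ s → Straddles (suc (k + 4)) (0 , 2 * s ∸ 1)) (≡-sym (+-suc k 4)) (straddles-last (k + 4))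
            ∷ map⁺ (All.map straddles-suc (mc-straddles k))

mc-nonempty : ∀ k → Σ (ℕ × ℕ) (_∈ mc k)
mc-nonempty zero = _ , here refl
mc-nonempty (suc k) with even? k
... | true  = _ , here refl
... | false = _ , here refl

module _ (m : ℕ) where

  private
    i : ℕ
    i = 4 + m

  MC-straddles : ∀ {x y} → (x , y) ∈ mc m → Straddles i (x , y)
  MC-straddles = All.lookup (subst (λ t → All (Straddles t) (mc m)) (+-comm m 4) (mc-straddles m))

  MC-crossing : ∀ {u v} → E (MC i) u v → Crosses i u v ⊎ Crosses i v u
  MC-crossing (inj₁ uv∈) = inj₁ (proj₁ (MC-straddles uv∈) , proj₁ (proj₂ (MC-straddles uv∈)))
  MC-crossing (inj₂ vu∈) = inj₂ (proj₁ (MC-straddles vu∈) , proj₁ (proj₂ (MC-straddles vu∈)))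

  MC-crossing-edge : ∀ {x y} → (x , y) ∈ mc m → ∃₂ λ u v → E (MC i) u v × Crosses i u v
  MC-crossing-edge {x} {y} xy∈ with MC-straddles xy∈
  ... | x<i , i≤y , y<2i = fromℕ< x<2i , fromℕ< y<2i , inj₁ uv∈ , u<i , i≤v
    where
    x<2i : x < 2 * i
    x<2i = <-trans x<i (≤-<-trans i≤y y<2i)
    uv∈ : (toℕ (fromℕ< x<2i) , toℕ (fromℕ< y<2i)) ∈ mc m
    uv∈ = subst₂ (λ u v → (u , v) ∈ mc m) (≡-sym (toℕ-fromℕ< x<2i)) (≡-sym (toℕ-fromℕ< y<2i)) xy∈
    u<i : toℕ (fromℕ< x<2i) < i
    u<i = subst (_< i) (≡-sym (toℕ-fromℕ< x<2i)) x<i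
    i≤v : i ≤ toℕ (fromℕ< y<2i)
    i≤v = subst (i ≤_) (≡-sym (toℕ-fromℕ< y<2i)) i≤y

lemma2 : ∀ (i : ℕ) → 3 < i → EdgeCollapsible (MC i)
lemma2 (suc (suc (suc (suc m)))) (s≤s (s≤s (s≤s (s≤s z≤n)))) =
  let (_ , _ , e , c) = MC-crossing-edge m (proj₂ (mc-nonempty m))
  in crossing⇒EdgeCollapsible (MC (4 + m)) (4 + m) (MC-crossing m) e c
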